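{- Let $M$ be an odd 2-multipede and $\theta$ an automorphism of $M$ such that $\theta(x)=x$ for every segment $x$. Then $\theta(a)=a$ for every foot $a$.
   Context: All structures are finite. For a binary relation $E$, $D(E)=\{x:\exists y\,xEy\}$ and $R(E)=\{y:\exists x\,xEy\}$. A 1-multipede is a directed graph $(U,E)$ with $D(E)\cap R(E)=\emptyset$, $D(E)\cup R(E)=U$, every element of $D(E)$ having exactly one outgoing edge and every element of $R(E)$ exactly two incoming edges. Elements of $R(E)$ are segments, elements of $D(E)$ are feet; if $xEy$, $x$ is a foot of $y$ and $S(x)=y$; for a segment $x$, $S(x)=x$; $S(X)=\{S(x):x\in X\}$. A $2^-$-multipede is a structure $(U,E,T)$ where $(U,E)$ is a 1-multipede and $T$ is a set of 3-element subsets of $U$ (hyperedges) such that each hyperedge consists either entirely of segments or entirely of feet, and for each foot hyperedge $h$, $S(h)$ is a hyperedge. For a segment hyperedge $X$, a slave of $X$ is a 3-element set $A$ of feet with $S(A)=X$; it is positive if $A\in T$, negative otherwise. Two slaves of $X$ are equivalent if they are equal or one is obtained from the other by replacing the feet of exactly two of the segments by the other feet of those segments. A 2-multipede is a $2^-$-multipede in which, for every segment hyperedge $X$, exactly four slaves of $X$ are positive and these four are pairwise equivalent. The segment hypergraph is $(R(E),\{h\in T: h\subseteq R(E)\})$. A hypergraph is odd if for every nonempty vertex set $X$ some hyperedge $h$ has $|h\cap X|$ odd; a 2-multipede is odd if its segment hypergraph is odd. -}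

module Defs where

open import Data.Nat using (ℕ; _%_)
open import Data.Fin using (Fin)
open import Data.Fin.Subset using (Subset; _∈_; _∉_; _∩_; ∣_∣; Nonempty)
open import Data.Fin.Permutation using (Permutation′; _⟨$⟩ʳ_; _⟨$⟩ˡ_)
open import Data.Vec using (tabulate; lookup)
open import Data.Product using (Σ; ∃; _×_; _,_)
open import Data.Sum using (_⊎_)
open import Relation.Nullary using (¬_)
open import Relation.Binary.PropositionalEquality using (_≡_; _≢_)
open import Function.Bundles using (_⇔_)

-- A finite structure with universe Fin n, a binary relation E and a
-- set T of subsets (intended hyperedges).
record Str (n : ℕ) : Set₁ where
  field
    E : Fin n → Fin n → Set
    T : Subset n → Set

module _ {n : ℕ} (M : Str n) where
  open Str M

  Dom : Fin n → Set
  Dom x = ∃ λ y → E x y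

  Rng : Fin n → Set
  Rng y = ∃ λ x → E x y

  Is1Multipede : Set
  Is1Multipede =
    (∀ x → ¬ (Dom x × Rng x)) ×
    (∀ x → Dom x ⊎ Rng x) ×
    (∀ x → Dom x → ∃ λ y → E x y × (∀ z → E x z → z ≡ y)) ×
    (∀ y → Rng y → Σ (Fin n) λ a → Σ (Fin n) λ b →
        a ≢ b × E a y × E b y × (∀ z → E z y → z ≡ a ⊎ z ≡ b))

  -- SRel x y  means  S(x) = y
  SRel : Fin n → Fin n → Set
  SRel x y = E x y ⊎ (Rng x × y ≡ x)

  ImageS : Subset n → Subset n → Set
  ImageS h Y = ∀ y → y ∈ Y ⇔ (∃ λ x → x ∈ h × SRel x y)

  AllSeg : Subset n → Set
  AllSeg h = ∀ x → x ∈ h → Rng x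

  AllFeet : Subset n → Set
  AllFeet h = ∀ x → x ∈ h → Dom x

  Is2⁻Multipede : Set
  Is2⁻Multipede =
    Is1Multipede ×
    (∀ h → T h → ∣ h ∣ ≡ 3) ×
    (∀ h → T h → AllSeg h ⊎ AllFeet h) ×
    (∀ h → T h → AllFeet h → ∃ λ Y → ImageS h Y × T Y)

  SegEdge : Subset n → Set
  SegEdge X = T X × AllSeg X

  Slave : Subset n → Subset n → Set
  Slave X A = ∣ A ∣ ≡ 3 × AllFeet A × ImageS A X

  PosSlave : Subset n → Subset n → Set
  PosSlave X A = Slave X A × T A

  -- equivalence of slaves of X: equal, or B is obtained from A by replacing
  -- the feet of exactly two (distinct) segments s₁ s₂ of X by their other feet
  SlaveEquiv : Subset n → Subset n → Subset n → Set
  SlaveEquiv X A B =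
    A ≡ B ⊎
    (Σ (Fin n) λ s₁ → Σ (Fin n) λ s₂ → s₁ ≢ s₂ × s₁ ∈ X × s₂ ∈ X ×
      (∀ a → a ∈ B ⇔ ((a ∈ A × ¬ E a s₁ × ¬ E a s₂) ⊎ (a ∉ A × (E a s₁ ⊎ E a s₂)))))

  Is2Multipede : Set
  Is2Multipede =
    Is2⁻Multipede ×
    (∀ X → SegEdge X →
      (Σ (Subset n) λ A₁ → Σ (Subset n) λ A₂ → Σ (Subset n) λ A₃ → Σ (Subset n) λ A₄ →
        PosSlave X A₁ × PosSlave X A₂ × PosSlave X A₃ × PosSlave X A₄ ×
        A₁ ≢ A₂ × A₁ ≢ A₃ × A₁ ≢ A₄ × A₂ ≢ A₃ × A₂ ≢ A₄ × A₃ ≢ A₄ ×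
        (∀ B → PosSlave X B → B ≡ A₁ ⊎ B ≡ A₂ ⊎ B ≡ A₃ ⊎ B ≡ A₄)) ×
      (∀ A B → PosSlave X A → PosSlave X B → SlaveEquiv X A B))

  IsOdd : Set
  IsOdd = ∀ X → Nonempty X → (∀ x → x ∈ X → Rng x) →
          ∃ λ h → SegEdge h × ∣ h ∩ X ∣ % 2 ≡ 1

  image : Permutation′ n → Subset n → Subset n
  image θ X = tabulate λ i → lookup X (θ ⟨$⟩ˡ i)

  IsAutomorphism : Permutation′ n → Set
  IsAutomorphism θ =
    (∀ x y → E x y ⇔ E (θ ⟨$⟩ʳ x) (θ ⟨$⟩ʳ y)) ×
    (∀ X → T X ⇔ T (image θ X))

-- Let X be the set of segments whose two feet are swapped by θ. If X were nonempty, oddness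
-- would give a segment hyperedge h with |h ∩ X| odd. For a positive slave A of h, θ(A) is
-- again a positive slave of h, hence equivalent to A. Since A contains exactly one foot of
-- each segment of h, the segments at which A and θ(A) differ are exactly those of h ∩ X,
-- so |h ∩ X| is 0 or 2.
module Submission where

open import Defs
open import Data.Nat using (ℕ; suc; _≤_; _%_; s≤s; z≤n)
open import Data.Nat.Properties using (≤-trans; ≤-reflexive; ≤-antisym; n≤1+n; n≤0⇒n≡0; <⇒≱)
open import Data.Fin using (Fin; zero; suc; _≟_)
open import Data.Fin.Properties using (any?)
open import Data.Fin.Subset using (Subset; Side; inside; outside; _∈_; _∉_; _∩_; _-_; ∣_∣)
open import Data.Fin.Subset.Properties
  using (p─⊥≡p; Empty-unique; ∣⊥∣≡0; x∈p∧x≢y⇒x∈p-y; x∈p⇒∣p-x∣<∣p∣; p─q⊆p; x∈p∩q⁺; x∈p∩q⁻)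
open import Data.Fin.Permutation using (Permutation′; _⟨$⟩ʳ_; _⟨$⟩ˡ_; inverseˡ; inverseʳ)
open import Data.Vec using ([]; _∷_; tabulate)
import Data.Vec as Vec
open import Data.Vec.Properties using (lookup∘tabulate; []=⇒lookup; lookup⇒[]=)
open import Data.List using (List; length; map) renaming ([] to []ᴸ; _∷_ to _∷ᴸ_)
open import Data.List.Properties using (length-map)
open import Data.List.Membership.Propositional using () renaming (_∈_ to _∈ᴸ_)
open import Data.List.Membership.Propositional.Properties using (∈-map⁺)
open import Data.List.Relation.Unary.Any using (here; there)
open import Data.Product using (∃; _×_; _,_; proj₁; proj₂)
open import Data.Sum using (_⊎_; inj₁; inj₂)
open import Data.Empty using (⊥-elim)
open import Function using (_∘_; case_of_)
open import Function.Bundles using (_⇔_; mk⇔; Equivalence)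
open import Relation.Nullary using (¬_; Dec; yes; no)
open import Relation.Nullary.Decidable using (_×-dec_; ¬?; ⌊_⌋; toWitness; fromWitness)
open import Data.Bool.Properties using (T-≡)
open import Relation.Binary.PropositionalEquality
  using (_≡_; _≢_; refl; sym; trans; cong; subst; subst₂)

private variable
  m n : ℕ

x∉p-x : ∀ (p : Subset n) x → x ∉ p - x
x∉p-x (s ∷ p) (suc x) (Vec.there x∈p-x) = x∉p-x p x x∈p-x

∣p∣≤1+∣p-x∣ : ∀ (p : Subset n) x → ∣ p ∣ ≤ suc ∣ p - x ∣
∣p∣≤1+∣p-x∣ (inside  ∷ p) zero    = ≤-reflexive (cong (suc ∘ ∣_∣) (sym (p─⊥≡p p)))
∣p∣≤1+∣p-x∣ (outside ∷ p) zero    = ≤-trans (n≤1+n ∣ p ∣) (≤-reflexive (cong (suc ∘ ∣_∣) (sym (p─⊥≡p p))))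
∣p∣≤1+∣p-x∣ (inside  ∷ p) (suc x) = s≤s (∣p∣≤1+∣p-x∣ p x)
∣p∣≤1+∣p-x∣ (outside ∷ p) (suc x) = ∣p∣≤1+∣p-x∣ p x

p⊆xs⇒∣p∣≤length : ∀ {p : Subset n} xs → (∀ {x} → x ∈ p → x ∈ᴸ xs) → ∣ p ∣ ≤ length xs
p⊆xs⇒∣p∣≤length {n} {p} []ᴸ p⊆[] =
  ≤-reflexive (trans (cong ∣_∣ (Empty-unique λ (_ , x∈p) → case p⊆[] x∈p of λ ())) (∣⊥∣≡0 n))
p⊆xs⇒∣p∣≤length {p = p} (y ∷ᴸ ys) p⊆y∷ys =
  ≤-trans (∣p∣≤1+∣p-x∣ p y) (s≤s (p⊆xs⇒∣p∣≤length ys p-y⊆ys))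
  where
  p-y⊆ys : ∀ {x} → x ∈ p - y → x ∈ᴸ ys
  p-y⊆ys {x} x∈p-y with p⊆y∷ys (p─q⊆p p _ x∈p-y)
  ... | here refl  = ⊥-elim (x∉p-x p y x∈p-y)
  ... | there x∈ys = x∈ys

members : Subset n → List (Fin n)
members []            = []ᴸ
members (inside  ∷ p) = zero ∷ᴸ map suc (members p)
members (outside ∷ p) = map suc (members p)

length-members : ∀ (p : Subset n) → length (members p) ≡ ∣ p ∣
length-members []            = refl
length-members (inside  ∷ p) = cong suc (trans (length-map suc (members p)) (length-members p))
length-members (outside ∷ p) = trans (length-map suc (members p)) (length-members p)

∈⇒∈members : ∀ {p : Subset n} {x} → x ∈ p → x ∈ᴸ members p
∈⇒∈members {p = inside  ∷ p} Vec.here          = here refl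
∈⇒∈members {p = inside  ∷ p} (Vec.there x∈p)   = there (∈-map⁺ suc (∈⇒∈members x∈p))
∈⇒∈members {p = outside ∷ p} (Vec.there x∈p)   = ∈-map⁺ suc (∈⇒∈members x∈p)

q⊆f[p]⇒∣q∣≤∣p∣ : ∀ {p : Subset m} {q : Subset n} (f : Fin m → Fin n) →
                 (∀ {y} → y ∈ q → ∃ λ x → x ∈ p × f x ≡ y) → ∣ q ∣ ≤ ∣ p ∣
q⊆f[p]⇒∣q∣≤∣p∣ {p = p} {q} f q⊆f[p] =
  subst (_ ≤_) (trans (length-map f (members p)) (length-members p))
        (p⊆xs⇒∣p∣≤length (map f (members p)) y∈f[p])
  where
  y∈f[p] : ∀ {y} → y ∈ q → y ∈ᴸ map f (members p)
  y∈f[p] y∈q with q⊆f[p] y∈q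
  ... | x , x∈p , refl = ∈-map⁺ f (∈⇒∈members x∈p)

x∈p∧y∈p∧x≢y⇒2≤∣p∣ : ∀ {p : Subset n} {x y} → x ∈ p → y ∈ p → x ≢ y → 2 ≤ ∣ p ∣
x∈p∧y∈p∧x≢y⇒2≤∣p∣ x∈p y∈p x≢y =
  ≤-trans (s≤s (≤-trans (s≤s z≤n) (x∈p⇒∣p-x∣<∣p∣ (x∈p∧x≢y⇒x∈p-y x∈p x≢y))))
          (x∈p⇒∣p-x∣<∣p∣ y∈p)

∈tabulate⇔ : ∀ (f : Fin n → Side) {x} → x ∈ tabulate f ⇔ f x ≡ inside
∈tabulate⇔ f {x} = mk⇔
  (λ x∈f → trans (sym (lookup∘tabulate f x)) ([]=⇒lookup x∈f))
  (λ fx≡inside → lookup⇒[]= x (tabulate f) (trans (lookup∘tabulate f x) fx≡inside))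

module _ (M : Str n) (θ : Permutation′ n) {A : Subset n} where

  ∈image⇔ : ∀ {x} → x ∈ image M θ A ⇔ θ ⟨$⟩ˡ x ∈ A
  ∈image⇔ {x} = mk⇔
    (λ x∈θA → lookup⇒[]= (θ ⟨$⟩ˡ x) A (Equivalence.to (∈tabulate⇔ _) x∈θA))
    (λ θ⁻¹x∈A → Equivalence.from (∈tabulate⇔ _) ([]=⇒lookup θ⁻¹x∈A))

  ∈image⁺ : ∀ {x} → x ∈ A → θ ⟨$⟩ʳ x ∈ image M θ A
  ∈image⁺ x∈A = Equivalence.from ∈image⇔ (subst (_∈ A) (sym (inverseˡ θ)) x∈A)

module OneMultipede (M : Str n) (is1 : Is1Multipede M) where
  open Str M

  foot-not-segment : ∀ {x} → Dom M x → ¬ Rng M x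
  foot-not-segment {x} x-foot x-seg = proj₁ is1 x (x-foot , x-seg)

  E-functional : ∀ {c a b} → E c a → E c b → a ≡ b
  E-functional {c} {a} {b} c→a c→b =
    let _ , _ , unique = proj₁ (proj₂ (proj₂ is1)) c (a , c→a)
    in trans (unique a c→a) (sym (unique b c→b))

  segment : Fin n → Fin n
  segment x with proj₁ (proj₂ is1) x
  ... | inj₁ (y , _) = y
  ... | inj₂ _       = x

  E⇒segment≡ : ∀ {c w} → E c w → segment c ≡ w
  E⇒segment≡ {c} {w} c→w with proj₁ (proj₂ is1) c
  ... | inj₁ (_ , c→y) = E-functional c→y c→w
  ... | inj₂ c-seg     = ⊥-elim (foot-not-segment (w , c→w) c-seg)

  E? : ∀ c w → Dec (E c w)
  E? c w with proj₁ (proj₂ is1) c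
  ... | inj₂ c-seg = no λ c→w → foot-not-segment (w , c→w) c-seg
  ... | inj₁ (y , c→y) with w ≟ y
  ...   | yes refl = yes c→y
  ...   | no w≢y   = no λ c→w → w≢y (E-functional c→w c→y)

  SRel⇒E : ∀ {c w} → Dom M c → SRel M c w → E c w
  SRel⇒E _      (inj₁ c→w)        = c→w
  SRel⇒E c-foot (inj₂ (c-seg , _)) = ⊥-elim (foot-not-segment c-foot c-seg)

  other-foot-unique : ∀ {a b c w} → E a w → E b w → E c w → a ≢ c → b ≢ c → a ≡ b
  other-foot-unique {a} {b} {c} {w} a→w b→w c→w a≢c b≢c
    with proj₂ (proj₂ (proj₂ is1)) w (c , c→w)
  ... | _ , _ , _ , _ , _ , feet with feet a a→w | feet b b→w | feet c c→w
  ... | inj₁ a≡p | inj₁ b≡p | _        = trans a≡p (sym b≡p)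
  ... | inj₂ a≡q | inj₂ b≡q | _        = trans a≡q (sym b≡q)
  ... | inj₁ a≡p | inj₂ _   | inj₁ c≡p = ⊥-elim (a≢c (trans a≡p (sym c≡p)))
  ... | inj₁ _   | inj₂ b≡q | inj₂ c≡q = ⊥-elim (b≢c (trans b≡q (sym c≡q)))
  ... | inj₂ _   | inj₁ b≡p | inj₁ c≡p = ⊥-elim (b≢c (trans b≡p (sym c≡p)))
  ... | inj₂ a≡q | inj₁ _   | inj₂ c≡q = ⊥-elim (a≢c (trans a≡q (sym c≡q)))

  module _ {h A : Subset n} (A-slave : Slave M h A) where

    slave-foot : ∀ {w} → w ∈ h → ∃ λ c → c ∈ A × E c w
    slave-foot {w} w∈h =
      let c , c∈A , c↦w = Equivalence.to (proj₂ (proj₂ A-slave) w) w∈h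
      in c , c∈A , SRel⇒E (proj₁ (proj₂ A-slave) c c∈A) c↦w

    slave-segment : ∀ {c w} → c ∈ A → E c w → w ∈ h
    slave-segment {c} {w} c∈A c→w = Equivalence.from (proj₂ (proj₂ A-slave) w) (c , c∈A , inj₁ c→w)

    -- Two feet c ≢ d of one segment would let S map A − c onto h, so |h| ≤ |A − c| < |A|.
    slave-foot-unique : ∣ A ∣ ≤ ∣ h ∣ → ∀ {c d w} → c ∈ A → d ∈ A → E c w → E d w → c ≡ d
    slave-foot-unique ∣A∣≤∣h∣ {c} {d} {w} c∈A d∈A c→w d→w with c ≟ d
    ... | yes c≡d = c≡d
    ... | no  c≢d = ⊥-elim (<⇒≱ (x∈p⇒∣p-x∣<∣p∣ c∈A) (≤-trans ∣A∣≤∣h∣ (q⊆f[p]⇒∣q∣≤∣p∣ segment h⊆S[A-c])))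
      where
      h⊆S[A-c] : ∀ {s} → s ∈ h → ∃ λ e → e ∈ A - c × segment e ≡ s
      h⊆S[A-c] s∈h with slave-foot s∈h
      ... | e , e∈A , e→s with e ≟ c
      ...   | yes refl = d , x∈p∧x≢y⇒x∈p-y d∈A (c≢d ∘ sym) , trans (E⇒segment≡ d→w) (E-functional c→w e→s)
      ...   | no  e≢c  = e , x∈p∧x≢y⇒x∈p-y e∈A e≢c , E⇒segment≡ e→s

module SegmentFixing (M : Str n) (is1 : Is1Multipede M) (θ : Permutation′ n)
                     (E-preserved : ∀ x y → Str.E M x y ⇔ Str.E M (θ ⟨$⟩ʳ x) (θ ⟨$⟩ʳ y))
                     (fixes-segments : ∀ x → Rng M x → θ ⟨$⟩ʳ x ≡ x) where
  open Str M
  open OneMultipede M is1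

  E-θ : ∀ {c w} → E c w → E (θ ⟨$⟩ʳ c) w
  E-θ {c} {w} c→w = subst (E _) (fixes-segments w (c , c→w)) (Equivalence.to (E-preserved c w) c→w)

  E-θ⁻¹ : ∀ {c w} → E c w → E (θ ⟨$⟩ˡ c) w
  E-θ⁻¹ {c} {w} c→w = Equivalence.from (E-preserved (θ ⟨$⟩ˡ c) w)
    (subst₂ E (sym (inverseʳ θ)) (sym (fixes-segments w (c , c→w))) c→w)

  fixed-foot⇒fixed-feet : ∀ {c f w} → E c w → θ ⟨$⟩ʳ c ≡ c → E f w → θ ⟨$⟩ʳ f ≡ f
  fixed-foot⇒fixed-feet {c} {f} c→w θc≡c f→w with f ≟ c
  ... | yes refl = θc≡c
  ... | no  f≢c  = other-foot-unique (E-θ f→w) f→w c→w θf≢c f≢c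
    where
    θf≢c : θ ⟨$⟩ʳ f ≢ c
    θf≢c θf≡c = f≢c (trans (sym (inverseˡ θ)) (trans (cong (θ ⟨$⟩ˡ_) (trans θf≡c (sym θc≡c))) (inverseˡ θ)))

  Moved : Fin n → Set
  Moved w = ∃ λ f → E f w × θ ⟨$⟩ʳ f ≢ f

  Moved? : ∀ w → Dec (Moved w)
  Moved? w = any? λ f → E? f w ×-dec ¬? (θ ⟨$⟩ʳ f ≟ f)

  moved : Subset n
  moved = tabulate (⌊_⌋ ∘ Moved?)

  ∈moved⇔ : ∀ {w} → w ∈ moved ⇔ Moved w
  ∈moved⇔ {w} = mk⇔
    (λ w∈moved → toWitness {a? = Moved? w} (Equivalence.from T-≡ (Equivalence.to (∈tabulate⇔ _) w∈moved)))
    (λ Moved-w → Equivalence.from (∈tabulate⇔ _) (Equivalence.to T-≡ (fromWitness Moved-w)))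

  moved⇒segment : ∀ w → w ∈ moved → Rng M w
  moved⇒segment w w∈moved = let f , f→w , _ = Equivalence.to ∈moved⇔ w∈moved in f , f→w

  image-PosSlave : (∀ X → T X → ∣ X ∣ ≡ 3) → (∀ X → T X ⇔ T (image M θ X)) →
                   ∀ {h A} → PosSlave M h A → PosSlave M h (image M θ A)
  image-PosSlave hyperedge-size T-preserved {h} {A} (A-slave@(_ , A-feet , _) , A∈T) =
    (hyperedge-size _ θA∈T , θA-feet , S[θA]≡h) , θA∈T
    where
    θA∈T : T (image M θ A)
    θA∈T = Equivalence.to (T-preserved A) A∈T

    θA-feet : AllFeet M (image M θ A)
    θA-feet x x∈θA =
      let y , θ⁻¹x→y = A-feet _ (Equivalence.to (∈image⇔ M θ) x∈θA)
      in y , subst (λ z → E z y) (inverseʳ θ) (E-θ θ⁻¹x→y)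

    S[θA]≡h : ImageS M (image M θ A) h
    S[θA]≡h y = mk⇔
      (λ y∈h → let c , c∈A , c→y = slave-foot A-slave y∈h
               in θ ⟨$⟩ʳ c , ∈image⁺ M θ c∈A , inj₁ (E-θ c→y))
      (λ (x , x∈θA , x↦y) → slave-segment A-slave (Equivalence.to (∈image⇔ M θ) x∈θA)
                                                    (E-θ⁻¹ (SRel⇒E (θA-feet x x∈θA) x↦y)))

  module _ {h A : Subset n} (A-slave : Slave M h A) (∣A∣≤∣h∣ : ∣ A ∣ ≤ ∣ h ∣) where

    moved⇔foot-leaves : ∀ {c w} → c ∈ A → E c w → (w ∈ moved ⇔ c ∉ image M θ A)
    moved⇔foot-leaves {c} {w} c∈A c→w = mk⇔ moved⇒leaves leaves⇒moved
      where
      moved⇒leaves : w ∈ moved → c ∉ image M θ A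
      moved⇒leaves w∈moved c∈θA =
        let f , f→w , θf≢f = Equivalence.to ∈moved⇔ w∈moved
            θ⁻¹c≡c = slave-foot-unique A-slave ∣A∣≤∣h∣
                       (Equivalence.to (∈image⇔ M θ) c∈θA) c∈A (E-θ⁻¹ c→w) c→w
            θc≡c = trans (cong (θ ⟨$⟩ʳ_) (sym θ⁻¹c≡c)) (inverseʳ θ)
        in θf≢f (fixed-foot⇒fixed-feet c→w θc≡c f→w)

      leaves⇒moved : c ∉ image M θ A → w ∈ moved
      leaves⇒moved c∉θA = Equivalence.from ∈moved⇔ (θ ⟨$⟩ˡ c , E-θ⁻¹ c→w , θ⁻¹c-moved)
        where
        θ⁻¹c-moved : θ ⟨$⟩ʳ (θ ⟨$⟩ˡ c) ≢ θ ⟨$⟩ˡ c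
        θ⁻¹c-moved θθ⁻¹c≡θ⁻¹c = c∉θA (Equivalence.from (∈image⇔ M θ)
          (subst (_∈ A) (trans (sym (inverseʳ θ)) θθ⁻¹c≡θ⁻¹c) c∈A))

    ≡image⇒∣h∩moved∣≡0 : A ≡ image M θ A → ∣ h ∩ moved ∣ ≡ 0
    ≡image⇒∣h∩moved∣≡0 A≡θA = n≤0⇒n≡0 (p⊆xs⇒∣p∣≤length []ᴸ h∩moved⊆[])
      where
      h∩moved⊆[] : ∀ {w} → w ∈ h ∩ moved → w ∈ᴸ []ᴸ
      h∩moved⊆[] w∈h∩moved =
        let w∈h , w∈moved = x∈p∩q⁻ h moved w∈h∩moved
            c , c∈A , c→w = slave-foot A-slave w∈h
        in ⊥-elim (Equivalence.to (moved⇔foot-leaves c∈A c→w) w∈moved (subst (c ∈_) A≡θA c∈A))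

    swap⇒∣h∩moved∣≡2 :
      ∀ {s₁ s₂} → s₁ ≢ s₂ → s₁ ∈ h → s₂ ∈ h →
      (∀ a → a ∈ image M θ A ⇔ ((a ∈ A × ¬ E a s₁ × ¬ E a s₂) ⊎ (a ∉ A × (E a s₁ ⊎ E a s₂)))) →
      ∣ h ∩ moved ∣ ≡ 2
    swap⇒∣h∩moved∣≡2 {s₁} {s₂} s₁≢s₂ s₁∈h s₂∈h θA≡swap =
      ≤-antisym (p⊆xs⇒∣p∣≤length (s₁ ∷ᴸ s₂ ∷ᴸ []ᴸ) h∩moved⊆swapped)
                (x∈p∧y∈p∧x≢y⇒2≤∣p∣ (x∈p∩q⁺ (s₁∈h , swapped⇒moved s₁∈h (inj₁ refl)))
                                   (x∈p∩q⁺ (s₂∈h , swapped⇒moved s₂∈h (inj₂ refl))) s₁≢s₂)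
      where
      stays⇒unswapped : ∀ {c} → c ∈ A → c ∈ image M θ A → ¬ E c s₁ × ¬ E c s₂
      stays⇒unswapped c∈A c∈θA with Equivalence.to (θA≡swap _) c∈θA
      ... | inj₁ (_ , c↛s₁ , c↛s₂) = c↛s₁ , c↛s₂
      ... | inj₂ (c∉A , _)         = ⊥-elim (c∉A c∈A)

      swapped⇒moved : ∀ {s} → s ∈ h → s ≡ s₁ ⊎ s ≡ s₂ → s ∈ moved
      swapped⇒moved s∈h s-swapped with slave-foot A-slave s∈h
      ... | c , c∈A , c→s = Equivalence.from (moved⇔foot-leaves c∈A c→s) λ c∈θA →
        case s-swapped of λ where
          (inj₁ refl) → proj₁ (stays⇒unswapped c∈A c∈θA) c→s
          (inj₂ refl) → proj₂ (stays⇒unswapped c∈A c∈θA) c→s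

      h∩moved⊆swapped : ∀ {w} → w ∈ h ∩ moved → w ∈ᴸ s₁ ∷ᴸ s₂ ∷ᴸ []ᴸ
      h∩moved⊆swapped {w} w∈h∩moved with w ≟ s₁ | w ≟ s₂
      ... | yes w≡s₁ | _        = here w≡s₁
      ... | no _     | yes w≡s₂ = there (here w≡s₂)
      ... | no w≢s₁  | no w≢s₂  =
        let w∈h , w∈moved = x∈p∩q⁻ h moved w∈h∩moved
            c , c∈A , c→w = slave-foot A-slave w∈h
        in ⊥-elim (Equivalence.to (moved⇔foot-leaves c∈A c→w) w∈moved
             (Equivalence.from (θA≡swap c)
               (inj₁ (c∈A , w≢s₁ ∘ E-functional c→w , w≢s₂ ∘ E-functional c→w))))

    SlaveEquiv⇒∣h∩moved∣-even : SlaveEquiv M h A (image M θ A) → ∣ h ∩ moved ∣ % 2 ≡ 0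
    SlaveEquiv⇒∣h∩moved∣-even (inj₁ A≡θA) rewrite ≡image⇒∣h∩moved∣≡0 A≡θA = refl
    SlaveEquiv⇒∣h∩moved∣-even (inj₂ (_ , _ , s₁≢s₂ , s₁∈h , s₂∈h , θA≡swap))
      rewrite swap⇒∣h∩moved∣≡2 s₁≢s₂ s₁∈h s₂∈h θA≡swap = refl

lemma4p1 : (n : ℕ) (M : Str n) → Is2Multipede M → IsOdd M →
           (θ : Permutation′ n) → IsAutomorphism M θ →
           (∀ x → Rng M x → θ ⟨$⟩ʳ x ≡ x) →
           ∀ a → Dom M a → θ ⟨$⟩ʳ a ≡ a
lemma4p1 _ M ((is1 , hyperedge-size , _) , slaves) odd θ (E-preserved , T-preserved) fixes-segments =
  fixes-feet
  where
  open SegmentFixing M is1 θ E-preserved fixes-segments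

  fixes-feet : ∀ a → Dom M a → θ ⟨$⟩ʳ a ≡ a
  fixes-feet a (s , a→s) with θ ⟨$⟩ʳ a ≟ a
  ... | yes θa≡a = θa≡a
  ... | no  θa≢a with odd moved (s , Equivalence.from ∈moved⇔ (a , a→s , θa≢a)) moved⇒segment
  ... | h , h-seg@(h∈T , _) , ∣h∩moved∣-odd with proj₁ (slaves h h-seg)
  ... | A , _ , _ , _ , A⁺@((∣A∣≡3 , _) , _) , _ =
    case trans (sym ∣h∩moved∣-odd) (SlaveEquiv⇒∣h∩moved∣-even (proj₁ A⁺) ∣A∣≤∣h∣ A≃θA) of λ ()
    where
    ∣A∣≤∣h∣ : ∣ A ∣ ≤ ∣ h ∣
    ∣A∣≤∣h∣ = ≤-reflexive (trans ∣A∣≡3 (sym (hyperedge-size h h∈T)))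
    A≃θA : SlaveEquiv M h A (image M θ A)
    A≃θA = proj₂ (slaves h h-seg) A (image M θ A) A⁺ (image-PosSlave hyperedge-size T-preserved A⁺)
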